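{- Let $G=(V,E)$ be a finite simple undirected graph and $W$ a vertex cover of $G$. Let $\Omega$ be a potential maximal clique of $G$ having an active separator $S\subseteq\Omega$ with an active pair $x,y\in S$. Let $C$ be the unique connected component of $G-S$ intersecting $\Omega$, and let $D_S$ be the union of all other connected components of $G-S$. Let $D_x$ be the union of the components of $G-\Omega$ that are contained in $C$ and see $x$, and $D_y$ the union of the components of $G-\Omega$ that are contained in $C$ and do not see $x$. Let $D_S^W=D_S\cap W$, $D_x^W=D_x\cap W$ and $D_y^W=D_y\cap W$. Then one of the following holds: (1) there is a vertex $t\in\Omega$ such that $\Omega\setminus S=N(t)\cap C$; (2) there is a vertex $t\in\Omega$ such that $\Omega=N[t]$; (3) for every vertex $z\notin W$, $z\in\Omega$ if and only if either (a) $z$ sees $D_S^W$ and sees $D_x^W\cup D_y^W$, or (b) $z$ does not see $D_S^W$ but sees each of $D_x^W\cup\{x\}$, $D_y^W\cup\{y\}$ and $D_x^W\cup D_y^W$.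
   Context: $N(v)$ is the neighbourhood of $v$, $N[v]=N(v)\cup\{v\}$, and for $A\subseteq V$, $N(A)=\bigcup_{v\in A}N(v)\setminus A$. A vertex $z$ sees a set $A$ if $N(z)\cap A\neq\emptyset$. A vertex cover is a set meeting every edge. $G-A$ is the subgraph induced by $V\setminus A$; components are vertex sets of maximal connected induced subgraphs. A graph is chordal if every cycle of length at least four has a chord. A minimal triangulation of $G$ is a chordal graph $H=(V,E')$ with $E\subseteq E'$ such that no chordal graph $(V,E'')$ with $E\subseteq E''\subsetneq E'$ exists. A potential maximal clique of $G$ is a set $\Omega\subseteq V$ that is a maximal clique of some minimal triangulation of $G$. Active separator: let $\Omega$ be a potential maximal clique, $C_1,\dots,C_p$ the components of $G-\Omega$ and $S_i=N(C_i)$. For a fixed index, say $S_1$, let $G^+$ be obtained from $G$ by making into a clique every $S_j$ ($j\ge 2$) with $S_j\not\subseteq S_1$. Then $S_1$ is an active separator for $\Omega$ if $\Omega$ is not a clique in $G^+$, and a pair $x,y\in\Omega$ non-adjacent in $G^+$ is an active pair (such $x,y$ lie in $S_1$). It is known that for a potential maximal clique $\Omega$ and a minimal separator $S\subsetneq\Omega$, $\Omega\setminus S$ is contained in exactly one component of $G-S$. -}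

module Defs where

open import Data.Nat using (ℕ; suc; _≤_)
open import Data.Bool using (Bool; true; false)
open import Data.Fin using (Fin; toℕ)
open import Data.Fin.Subset using (Subset; _∈_; _∉_; _⊆_; ∁; Nonempty)
open import Data.Product using (Σ; ∃; _×_)
open import Data.Sum using (_⊎_)
open import Relation.Nullary using (¬_)
open import Relation.Binary.PropositionalEquality using (_≡_; _≢_)
open import Function.Definitions using (Injective)

record Graph (n : ℕ) : Set where
  field
    adj    : Fin n → Fin n → Bool
    sym    : ∀ u v → adj u v ≡ adj v u
    irrefl : ∀ u → adj u u ≡ false
open Graph public

Edge : ∀ {n} → Graph n → Fin n → Fin n → Set
Edge G u v = adj G u v ≡ true

_⊑_ : ∀ {n} → Graph n → Graph n → Set
G ⊑ H = ∀ u v → Edge G u v → Edge H u v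

CycAdj : ∀ {m} → Fin m → Fin m → Set
CycAdj {m} i j =
  (toℕ j ≡ suc (toℕ i)) ⊎ (toℕ i ≡ suc (toℕ j))
  ⊎ ((toℕ i ≡ 0 × suc (toℕ j) ≡ m) ⊎ (toℕ j ≡ 0 × suc (toℕ i) ≡ m))

IsCycle : ∀ {n} → Graph n → (m : ℕ) → (Fin m → Fin n) → Set
IsCycle G m c = Injective _≡_ _≡_ c × (∀ i j → CycAdj i j → Edge G (c i) (c j))

HasChord : ∀ {n} → Graph n → (m : ℕ) → (Fin m → Fin n) → Set
HasChord G m c = Σ (Fin m) λ i → Σ (Fin m) λ j →
  i ≢ j × ¬ CycAdj i j × Edge G (c i) (c j)

Chordal : ∀ {n} → Graph n → Set
Chordal {n} H = ∀ m → 4 ≤ m → (c : Fin m → Fin n) → IsCycle H m c → HasChord H m c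

MinimalTriangulation : ∀ {n} → Graph n → Graph n → Set
MinimalTriangulation G H =
  Chordal H × G ⊑ H ×
  ¬ (Σ (Graph _) λ H′ → Chordal H′ × G ⊑ H′ × H′ ⊑ H × ¬ (H ⊑ H′))

IsClique : ∀ {n} → Graph n → Subset n → Set
IsClique G K = ∀ u v → u ∈ K → v ∈ K → u ≢ v → Edge G u v

IsMaximalClique : ∀ {n} → Graph n → Subset n → Set
IsMaximalClique G K = IsClique G K × (∀ K′ → IsClique G K′ → K ⊆ K′ → K′ ⊆ K)

IsPMC : ∀ {n} → Graph n → Subset n → Set
IsPMC G Ω = Σ (Graph _) λ H → MinimalTriangulation G H × IsMaximalClique H Ω

data Walk {n} (G : Graph n) (X : Subset n) : Fin n → Fin n → Set where
  here : ∀ {u} → u ∈ X → Walk G X u u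
  step : ∀ {u w v} → u ∈ X → Edge G u w → Walk G X w v → Walk G X u v

Connected : ∀ {n} → Graph n → Subset n → Set
Connected G C = Nonempty C × (∀ u v → u ∈ C → v ∈ C → Walk G C u v)

IsComponent : ∀ {n} → Graph n → (A : Subset n) → Subset n → Set
IsComponent G A C =
  C ⊆ ∁ A × Connected G C × (∀ C′ → C ⊆ C′ → C′ ⊆ ∁ A → Connected G C′ → C′ ⊆ C)

InN : ∀ {n} → Graph n → Subset n → Fin n → Set
InN G A v = v ∉ A × Σ (Fin _) λ u → u ∈ A × Edge G u v

Sees : ∀ {n} → Graph n → Fin n → (Fin n → Set) → Set
Sees G z P = Σ (Fin _) λ a → P a × Edge G z a

IsVertexCover : ∀ {n} → Graph n → Subset n → Set
IsVertexCover G W = ∀ u v → Edge G u v → u ∈ W ⊎ v ∈ W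

IsCompSep : ∀ {n} → Graph n → Subset n → Subset n → Subset n → Set
IsCompSep G Ω S C₁ = IsComponent G Ω C₁ × (∀ v → v ∈ S → InN G C₁ v) × (∀ v → InN G C₁ v → v ∈ S)

-- adjacency in G⁺: G plus cliques on all N(Cⱼ) (Cⱼ component of G - Ω) with N(Cⱼ) ⊄ S
EdgePlus : ∀ {n} → Graph n → Subset n → Subset n → Fin n → Fin n → Set
EdgePlus G Ω S u v =
  Edge G u v ⊎
  (u ≢ v × Σ (Subset _) λ Cⱼ → IsComponent G Ω Cⱼ × ¬ (∀ w → InN G Cⱼ w → w ∈ S)
           × InN G Cⱼ u × InN G Cⱼ v)

IsActivePair : ∀ {n} → Graph n → Subset n → Subset n → Fin n → Fin n → Set
IsActivePair G Ω S x y =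
  (Σ (Subset _) λ C₁ → IsCompSep G Ω S C₁) ×
  x ∈ Ω × y ∈ Ω × x ≢ y × ¬ EdgePlus G Ω S x y

module Submission where

-- The one structural fact about a potential maximal clique Ω that is needed is that two
-- non-adjacent vertices of Ω have a common full component in G − Ω (Bouchitté–Todinca);
-- with it, Ω − S lies in C and no component of G − Ω inside C has all its neighbours in S.
-- A vertex z ∉ W has all its neighbours in W. If z ∈ S, its neighbours in C₁ give D_S^W, and
-- unless (1) holds, z misses a vertex of Ω − S or sees a vertex of C − Ω; either way z sees a
-- component of G − Ω inside C, i.e. D_x^W ∪ D_y^W. If z ∈ Ω − S, then z ∈ C sees no other
-- component of G − S, its common components with x and with y witness (b) (one seeing x
-- would make x, y adjacent in G⁺), and unless (2) holds the same argument gives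
-- D_x^W ∪ D_y^W. Conversely, a vertex z ∉ Ω seeing D_x^W ∪ D_y^W lies in a component D ⊆ C
-- of G − Ω; it therefore sees no D_S^W, and (b) would put x and y into N(D) ⊄ S, making
-- them adjacent in G⁺.

open import Defs
open import Data.Nat using (ℕ; zero; suc; _+_; _<_; _≤_; _≟_; z≤n; s≤s; _≤′_; ≤′-refl; ≤′-step)
open import Data.Nat.Properties
  using ( ≤′⇒≤; ≤⇒≤′; n<1+n; m<n⇒m<1+n; ≤-trans; <-≤-trans; ≤-<-trans; <-trans; <⇒≤; <⇒≢
        ; <-irrefl; <-asym; <-cmp; ≤-pred; suc-injective; m≤m+n; +-suc; +-monoʳ-≤)
open import Data.Bool using (true; _∧_; _∨_)
open import Data.Bool.Properties using (∧-comm)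
import Data.Bool as Bool
open import Data.Fin using (Fin; toℕ; fromℕ<)
open import Data.Fin.Properties
  using (any?; all?; ¬∀⟶∃¬; toℕ-fromℕ<; toℕ-injective; toℕ<n) renaming (_≟_ to _≟ᶠ_)
open import Data.Fin.Subset using (Subset; _∈_; _∉_; _⊆_; ∁; ⁅_⁆; _∪_; ∣_∣) renaming (⊥ to ∅)
open import Data.Fin.Subset.Properties
  using ( _∈?_; ∉⊥; x∈⁅x⁆; x∈⁅y⁆⇒x≡y; p⊆p∪q; x∈p∪q⁻; x∈p∪q⁺; x∈∁p⇒x∉p; x∉p⇒x∈∁p
        ; ∣p∣≤n; p⊂q⇒∣p∣<∣q∣; ⊆-antisym)
open import Data.Product using (Σ; ∃; ∃₂; _×_; _,_; proj₁; proj₂; swap)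
open import Data.Sum using (_⊎_; inj₁; inj₂; [_,_]′)
import Data.Sum as Sum
open import Data.Empty using (⊥; ⊥-elim)
open import Function using (_∘_; id)
open import Function.Bundles using (_⇔_; mk⇔; Equivalence)
open import Relation.Nullary using (¬_; Dec; yes; no; does; contradiction)
open import Relation.Nullary.Decidable using (_×-dec_; _⊎-dec_; _→-dec_; ¬?; map′; decidable-stable; dec-true)
open import Relation.Unary using (Pred; Decidable)
open import Relation.Binary.PropositionalEquality
  using (_≡_; _≢_; refl; cong; cong₂; subst; subst₂) renaming (sym to ≡-sym; trans to ≡-trans)
open import Relation.Binary.Definitions using (tri<; tri≈; tri>)

module _ {n} (G : Graph n) where

  edge? : ∀ u v → Dec (Edge G u v)
  edge? u v = adj G u v Bool.≟ true

  edge-sym : ∀ {u v} → Edge G u v → Edge G v u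
  edge-sym {u} {v} = ≡-trans (sym G v u)

  ClosedIn : Subset n → Subset n → Set
  ClosedIn X D = ∀ {u w} → u ∈ D → w ∈ X → Edge G u w → w ∈ D

module _ {n} {G : Graph n} where

  source∈ : ∀ {X u v} → Walk G X u v → u ∈ X
  source∈ (here u∈X)     = u∈X
  source∈ (step u∈X _ _) = u∈X

  target∈ : ∀ {X u v} → Walk G X u v → v ∈ X
  target∈ (here v∈X)   = v∈X
  target∈ (step _ _ r) = target∈ r

  _++ʷ_ : ∀ {X u v w} → Walk G X u v → Walk G X v w → Walk G X u w
  here _       ++ʷ q = q
  step u∈X e r ++ʷ q = step u∈X e (r ++ʷ q)

  reverseʷ : ∀ {X u v} → Walk G X u v → Walk G X v u
  reverseʷ (here u∈X)     = here u∈X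
  reverseʷ (step u∈X e r) = reverseʷ r ++ʷ step (source∈ r) (edge-sym G e) (here u∈X)

  Walk-mono : ∀ {X Y u v} → X ⊆ Y → Walk G X u v → Walk G Y u v
  Walk-mono X⊆Y (here u∈X)     = here (X⊆Y u∈X)
  Walk-mono X⊆Y (step u∈X e r) = step (X⊆Y u∈X) e (Walk-mono X⊆Y r)

  Walk-confine : ∀ {X D u v} → ClosedIn G X D → u ∈ D → Walk G X u v → Walk G D u v
  Walk-confine closed u∈D (here _)     = here u∈D
  Walk-confine closed u∈D (step _ e r) = step u∈D e (Walk-confine closed (closed u∈D (source∈ r) e) r)

  walk-target-in : ∀ {X D u v} → ClosedIn G X D → u ∈ D → Walk G X u v → v ∈ D
  walk-target-in closed u∈D = target∈ ∘ Walk-confine closed u∈D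

module _ {n} (G : Graph n) where

  closedIn-∁ : ∀ {A D} → (∀ q → InN G D q → q ∈ A) → ClosedIn G (∁ A) D
  closedIn-∁ {D = D} N[D]⊆A {u} {w} u∈D w∉A e with w ∈? D
  ... | yes w∈D = w∈D
  ... | no  w∉D = contradiction (N[D]⊆A w (w∉D , u , u∈D , e)) (x∈∁p⇒x∉p w∉A)

  module Reachability (X : Subset n) (a : Fin n) where

    Reached : Subset n → Set
    Reached R = ∀ {w} → w ∈ R → Walk G X a w

    Frontier : Subset n → Set
    Frontier R = ∃₂ λ u w → u ∈ R × w ∈ X × w ∉ R × Edge G u w

    frontier? : ∀ R → Dec (Frontier R)
    frontier? R = any? λ u → any? λ w → u ∈? R ×-dec w ∈? X ×-dec ¬? (w ∈? R) ×-dec edge? G u w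

    -- k is fuel: each round adds a vertex to R, so it never runs out.
    saturate : ∀ k R → n ≤ k + ∣ R ∣ → Reached R →
               Σ (Subset n) λ R′ → R ⊆ R′ × Reached R′ × ClosedIn G X R′
    saturate k R bound reached with frontier? R
    ... | no ¬frontier = R , id , reached , closed
      where
      closed : ClosedIn G X R
      closed {u} {w} u∈R w∈X e with w ∈? R
      ... | yes w∈R = w∈R
      ... | no  w∉R = contradiction (u , w , u∈R , w∈X , w∉R , e) ¬frontier
    ... | yes (u , w , u∈R , w∈X , w∉R , e) = grow k bound
      where
      R⁺ : Subset n
      R⁺ = R ∪ ⁅ w ⁆

      ∣R∣<∣R⁺∣ : ∣ R ∣ < ∣ R⁺ ∣
      ∣R∣<∣R⁺∣ = p⊂q⇒∣p∣<∣q∣ (p⊆p∪q ⁅ w ⁆ , w , x∈p∪q⁺ (inj₂ (x∈⁅x⁆ w)) , w∉R)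

      reached⁺ : Reached R⁺
      reached⁺ v∈R⁺ with x∈p∪q⁻ R ⁅ w ⁆ v∈R⁺
      ... | inj₁ v∈R = reached v∈R
      ... | inj₂ v∈⁅w⁆ with refl ← x∈⁅y⁆⇒x≡y w v∈⁅w⁆ =
        reached u∈R ++ʷ step (target∈ (reached u∈R)) e (here w∈X)

      grow : ∀ k → n ≤ k + ∣ R ∣ → Σ (Subset n) λ R′ → R ⊆ R′ × Reached R′ × ClosedIn G X R′
      grow zero    bound = contradiction (≤-<-trans bound (<-≤-trans ∣R∣<∣R⁺∣ (∣p∣≤n R⁺))) (<-irrefl refl)
      grow (suc k) bound =
        let R′ , R⁺⊆R′ , reached′ , closed′ = saturate k R⁺ bound⁺ reached⁺
        in R′ , R⁺⊆R′ ∘ p⊆p∪q ⁅ w ⁆ , reached′ , closed′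
        where
        bound⁺ : n ≤ k + ∣ R⁺ ∣
        bound⁺ = ≤-trans bound (subst (_≤ k + ∣ R⁺ ∣) (+-suc k ∣ R ∣) (+-monoʳ-≤ k ∣R∣<∣R⁺∣))

    reachable : Σ (Subset n) λ R → Reached R × ClosedIn G X R × (a ∈ X → a ∈ R)
    reachable with a ∈? X
    ... | yes a∈X =
      let R , ⁅a⁆⊆R , reached , closed = saturate n ⁅ a ⁆ (m≤m+n n _) reached-a
      in R , reached , closed , λ _ → ⁅a⁆⊆R (x∈⁅x⁆ a)
      where
      reached-a : Reached ⁅ a ⁆
      reached-a w∈⁅a⁆ with refl ← x∈⁅y⁆⇒x≡y a w∈⁅a⁆ = here a∈X
    ... | no a∉X =
      ∅ , (λ w∈∅ → ⊥-elim (∉⊥ w∈∅)) , (λ u∈∅ → ⊥-elim (∉⊥ u∈∅)) , λ a∈X → contradiction a∈X a∉X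

  -- Empty unless a ∈ X.
  reach : Subset n → Fin n → Subset n
  reach X a = proj₁ (Reachability.reachable X a)

  reach-walk : ∀ {X} a {w} → w ∈ reach X a → Walk G X a w
  reach-walk {X} a = proj₁ (proj₂ (Reachability.reachable X a))

  reach-closedIn : ∀ {X} a → ClosedIn G X (reach X a)
  reach-closedIn {X} a = proj₁ (proj₂ (proj₂ (Reachability.reachable X a)))

  ∈-reach : ∀ {X a} → a ∈ X → a ∈ reach X a
  ∈-reach {X} {a} = proj₂ (proj₂ (proj₂ (Reachability.reachable X a)))

  reach-isComponent : ∀ {A a} → a ∈ ∁ A → IsComponent G A (reach (∁ A) a)
  reach-isComponent {A} {a} a∉A = target∈ ∘ reach-walk a , (( a , a∈R) , connected) , maximal
    where
    R = reach (∁ A) a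
    a∈R = ∈-reach a∉A

    connected : ∀ u v → u ∈ R → v ∈ R → Walk G R u v
    connected u v u∈R v∈R =
      reverseʷ (from-a u∈R) ++ʷ from-a v∈R
      where
      from-a : ∀ {w} → w ∈ R → Walk G R a w
      from-a = Walk-confine (reach-closedIn a) a∈R ∘ reach-walk a

    maximal : ∀ C′ → R ⊆ C′ → C′ ⊆ ∁ A → Connected G C′ → C′ ⊆ R
    maximal C′ R⊆C′ C′⊆∁A (_ , walks) w∈C′ =
      walk-target-in (reach-closedIn a) a∈R (Walk-mono C′⊆∁A (walks a _ (R⊆C′ a∈R) w∈C′))

  component-closedIn : ∀ {A C} → IsComponent G A C → ClosedIn G (∁ A) C
  component-closedIn {A} {C} (C⊆∁A , (_ , walks) , maximal) {u} u∈C w∉A e =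
    maximal R C⊆R (proj₁ R-comp) (proj₁ (proj₂ R-comp)) (reach-closedIn u (∈-reach (C⊆∁A u∈C)) w∉A e)
    where
    R = reach (∁ A) u
    R-comp = reach-isComponent (C⊆∁A u∈C)

    C⊆R : C ⊆ R
    C⊆R c∈C = walk-target-in (reach-closedIn u) (∈-reach (C⊆∁A u∈C)) (Walk-mono C⊆∁A (walks _ _ u∈C c∈C))

  component-walk : ∀ {A C c w} → IsComponent G A C → c ∈ C → Walk G (∁ A) c w → w ∈ C
  component-walk C-comp = walk-target-in (component-closedIn C-comp)

  component-⊆ : ∀ {A C₁ C₂ v} → IsComponent G A C₁ → IsComponent G A C₂ → v ∈ C₁ → v ∈ C₂ → C₁ ⊆ C₂
  component-⊆ (C₁⊆∁A , (_ , walks) , _) C₂-comp v∈C₁ v∈C₂ c∈C₁ =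
    component-walk C₂-comp v∈C₂ (Walk-mono C₁⊆∁A (walks _ _ v∈C₁ c∈C₁))

  component-avoids : ∀ {A D w} → IsComponent G A D → w ∈ A → w ∉ D
  component-avoids (D⊆∁A , _) w∈A w∈D = x∈∁p⇒x∉p (D⊆∁A w∈D) w∈A

first-exit : ∀ {p} {P : Pred ℕ p} → Decidable P → ∀ {a b} → a ≤ b → P a → ¬ P b →
             ∃ λ k → a ≤ k × k < b × P k × ¬ P (suc k)
first-exit {P = P} P? a≤b = go (≤⇒≤′ a≤b)
  where
  go : ∀ {a b} → a ≤′ b → P a → ¬ P b → ∃ λ k → a ≤ k × k < b × P k × ¬ P (suc k)
  go ≤′-refl Pa ¬Pa = contradiction Pa ¬Pa
  go (≤′-step {b} a≤′b) Pa ¬P1+b with P? b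
  ... | yes Pb  = b , ≤′⇒≤ a≤′b , n<1+n b , Pb , ¬P1+b
  ... | no  ¬Pb =
    let k , a≤k , k<b , Pk , ¬P1+k = go a≤′b Pa ¬Pb
    in k , a≤k , m<n⇒m<1+n k<b , Pk , ¬P1+k

-- Positions 0, …, l of a cycle, where a P-position is never next to a Q-position.
module CyclicGapsℕ {p q} {P : Pred ℕ p} {Q : Pred ℕ q} (P? : Decidable P) (Q? : Decidable Q)
  (l : ℕ)
  (P-Q-apart : ∀ {k} → P k → ¬ Q (suc k)) (Q-P-apart : ∀ {k} → Q k → ¬ P (suc k))
  (P-Q-wrap : P l → ¬ Q 0) (Q-P-wrap : Q l → ¬ P 0) where

  Gap : ℕ → Set _
  Gap k = ¬ P k × ¬ Q k

  -- The last three conditions say that p and q are distinct and not cyclically adjacent.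
  TwoGaps : Set _
  TwoGaps = ∃₂ λ p q → Gap p × Gap q × suc p < q × q ≤ l × ¬ (p ≡ 0 × q ≡ l)

  -- One gap lies between i and j, the other on the arc from j over l and 0 back to i.
  two-gaps : ∀ {i j} → P i → Q j → i < j → j ≤ l → TwoGaps
  two-gaps {i} {suc j} Pi Q1+j (s≤s i≤j) 1+j≤l with first-exit P? i≤j Pi (λ Pj → P-Q-apart Pj Q1+j)
  ... | k₁ , i≤k₁ , k₁<j , Pk₁ , ¬P1+k₁ with Q? l
  ...   | no ¬Ql =
    let k₂ , 1+j≤k₂ , k₂<l , Qk₂ , ¬Q1+k₂ = first-exit Q? 1+j≤l Q1+j ¬Ql
    in suc k₁ , suc k₂ , (¬P1+k₁ , P-Q-apart Pk₁) , (Q-P-apart Qk₂ , ¬Q1+k₂) ,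
       s≤s (<-≤-trans (s≤s k₁<j) 1+j≤k₂) , k₂<l , λ { (() , _) }
  ...   | yes Ql =
    let k₃ , _ , k₃<i , ¬Pk₃ , ¬¬P1+k₃ = first-exit (¬? ∘ P?) z≤n (Q-P-wrap Ql) (λ ¬Pi → ¬Pi Pi)
    in k₃ , suc k₁ , (¬Pk₃ , λ Qk₃ → ¬¬P1+k₃ (Q-P-apart Qk₃)) , (¬P1+k₁ , P-Q-apart Pk₁) ,
       s≤s (<-≤-trans k₃<i i≤k₁) , <⇒≤ 1+k₁<l , λ (_ , 1+k₁≡l) → <⇒≢ 1+k₁<l 1+k₁≡l
    where
    1+k₁<l : suc k₁ < l
    1+k₁<l = <-≤-trans (s≤s k₁<j) 1+j≤l

separated⇒¬CycAdj : ∀ {m} {i j : Fin m} →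
                    suc (toℕ i) < toℕ j → ¬ (toℕ i ≡ 0 × suc (toℕ j) ≡ m) → ¬ CycAdj i j
separated⇒¬CycAdj 1+i<j _        (inj₁ j≡1+i)                = <-irrefl (≡-sym j≡1+i) 1+i<j
separated⇒¬CycAdj 1+i<j _        (inj₂ (inj₁ i≡1+j))         =
  <-asym (<-trans (n<1+n _) 1+i<j) (subst (_ <_) (≡-sym i≡1+j) (n<1+n _))
separated⇒¬CycAdj _     not-wrap (inj₂ (inj₂ (inj₁ wrap)))   = not-wrap wrap
separated⇒¬CycAdj 1+i<j _        (inj₂ (inj₂ (inj₂ (j≡0 , _)))) with () ← subst (_ <_) j≡0 1+i<j

module CyclicGaps {l} {X Y : Fin (suc l) → Set} (X? : Decidable X) (Y? : Decidable Y)
  (X-Y-apart : ∀ {i j} → CycAdj i j → X i → ¬ Y j) where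

  At : (Fin (suc l) → Set) → ℕ → Set
  At Z k = ∃ λ i → toℕ i ≡ k × Z i

  at? : ∀ {Z} → Decidable Z → Decidable (At Z)
  at? Z? k = any? λ i → toℕ i ≟ k ×-dec Z? i

  X→¬Y-next : ∀ {k} → At X k → ¬ At Y (suc k)
  X→¬Y-next (i , refl , Xi) (j , j≡1+i , Yj) = X-Y-apart (inj₁ j≡1+i) Xi Yj

  Y→¬X-next : ∀ {k} → At Y k → ¬ At X (suc k)
  Y→¬X-next (i , refl , Yi) (j , j≡1+i , Xj) = X-Y-apart (inj₂ (inj₁ j≡1+i)) Xj Yi

  X-Y-wrap : At X l → ¬ At Y 0
  X-Y-wrap (i , i≡l , Xi) (j , j≡0 , Yj) = X-Y-apart (inj₂ (inj₂ (inj₂ (j≡0 , cong suc i≡l)))) Xi Yj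

  Y-X-wrap : At Y l → ¬ At X 0
  Y-X-wrap (i , i≡l , Yi) (j , j≡0 , Xj) = X-Y-apart (inj₂ (inj₂ (inj₁ (j≡0 , cong suc i≡l)))) Xj Yi

  module XY = CyclicGapsℕ (at? X?) (at? Y?) l X→¬Y-next Y→¬X-next X-Y-wrap Y-X-wrap
  module YX = CyclicGapsℕ (at? Y?) (at? X?) l Y→¬X-next X→¬Y-next Y-X-wrap X-Y-wrap

  TwoGapPositions : Set
  TwoGapPositions = ∃₂ λ p q → p ≢ q × ¬ CycAdj p q × (¬ X p × ¬ Y p) × (¬ X q × ¬ Y q)

  positions : ∀ {p q} → ¬ At X p × ¬ At Y p → ¬ At X q × ¬ At Y q →
              suc p < q → q ≤ l → ¬ (p ≡ 0 × q ≡ l) → TwoGapPositions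
  positions {p} {q} (¬Xp , ¬Yp) (¬Xq , ¬Yq) 1+p<q q≤l not-wrap =
    p′ , q′ , p′≢q′ , separated⇒¬CycAdj separated not-wrap′ ,
    ((λ Xp′ → ¬Xp (p′ , tp , Xp′)) , (λ Yp′ → ¬Yp (p′ , tp , Yp′))) ,
    ((λ Xq′ → ¬Xq (q′ , tq , Xq′)) , (λ Yq′ → ¬Yq (q′ , tq , Yq′)))
    where
    q<1+l : q < suc l
    q<1+l = s≤s q≤l
    p<1+l : p < suc l
    p<1+l = <-trans (<-trans (n<1+n p) 1+p<q) q<1+l
    p′ q′ : Fin (suc l)
    p′ = fromℕ< p<1+l
    q′ = fromℕ< q<1+l
    tp : toℕ p′ ≡ p
    tp = toℕ-fromℕ< p<1+l
    tq : toℕ q′ ≡ q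
    tq = toℕ-fromℕ< q<1+l
    separated : suc (toℕ p′) < toℕ q′
    separated = subst₂ (λ a b → suc a < b) (≡-sym tp) (≡-sym tq) 1+p<q
    not-wrap′ : ¬ (toℕ p′ ≡ 0 × suc (toℕ q′) ≡ suc l)
    not-wrap′ (p′≡0 , 1+q′≡1+l) =
      not-wrap (≡-trans (≡-sym tp) p′≡0 , ≡-trans (≡-sym tq) (suc-injective 1+q′≡1+l))
    p′≢q′ : p′ ≢ q′
    p′≢q′ p′≡q′ = <⇒≢ (<-trans (n<1+n _) separated) (cong toℕ p′≡q′)

  two-gap-positions : (∀ i → X i → ¬ Y i) → ∀ {i j} → X i → Y j → TwoGapPositions
  two-gap-positions X∩Y=∅ {i} {j} Xi Yj with <-cmp (toℕ i) (toℕ j)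
  ... | tri≈ _ i≡j _ = contradiction (subst Y (≡-sym (toℕ-injective i≡j)) Yj) (X∩Y=∅ i Xi)
  ... | tri< i<j _ _ =
    let _ , _ , gap₁ , gap₂ , 1+p<q , q≤l , not-wrap =
          XY.two-gaps (i , refl , Xi) (j , refl , Yj) i<j (≤-pred (toℕ<n j))
    in positions gap₁ gap₂ 1+p<q q≤l not-wrap
  ... | tri> _ _ j<i =
    let _ , _ , gap₁ , gap₂ , 1+p<q , q≤l , not-wrap =
          YX.two-gaps (j , refl , Yj) (i , refl , Xi) j<i (≤-pred (toℕ<n i))
    in positions (swap gap₁) (swap gap₂) 1+p<q q≤l not-wrap

SameBlock : ∀ {n} → (B₁ B₂ : Fin n → Set) → Fin n → Fin n → Set
SameBlock B₁ B₂ u v = (B₁ u × B₁ v) ⊎ (B₂ u × B₂ v)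

module _ {n} (H : Graph n) {B₁ B₂ : Fin n → Set} (B₁? : Decidable B₁) (B₂? : Decidable B₂) where

  sameBlock? : ∀ u v → Dec (SameBlock B₁ B₂ u v)
  sameBlock? u v = (B₁? u ×-dec B₁? v) ⊎-dec (B₂? u ×-dec B₂? v)

  withinBlocks : Graph n
  withinBlocks = record
    { adj    = λ u v → adj H u v ∧ does (sameBlock? u v)
    ; sym    = λ u v → cong₂ _∧_ (sym H u v)
                                  (cong₂ _∨_ (∧-comm (does (B₁? u)) _) (∧-comm (does (B₂? u)) _))
    ; irrefl = λ u → cong (_∧ does (sameBlock? u u)) (irrefl H u)
    }

  withinBlocks-edge : ∀ {u v} → Edge H u v → SameBlock B₁ B₂ u v → Edge withinBlocks u v
  withinBlocks-edge {u} {v} e same = cong₂ _∧_ e (dec-true (sameBlock? u v) same)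

  withinBlocks-⊑ : withinBlocks ⊑ H
  withinBlocks-⊑ u v e with adj H u v
  ... | true = refl

  withinBlocks-sameBlock : ∀ {u v} → Edge withinBlocks u v → SameBlock B₁ B₂ u v
  withinBlocks-sameBlock {u} {v} e with adj H u v
  ... | true = does-true⁻¹ (sameBlock? u v) e
    where
    does-true⁻¹ : ∀ {P : Set} (P? : Dec P) → does P? ≡ true → P
    does-true⁻¹ (yes p) _ = p

  chord-within-block : Chordal H → ∀ m {c} → 4 ≤ m → IsCycle withinBlocks m c →
                       (∀ i j → SameBlock B₁ B₂ (c i) (c j)) → HasChord withinBlocks m c
  chord-within-block chordal m {c} 4≤m (c-injective , c-cycle) same
    with chordal m 4≤m c (c-injective , λ i j a → withinBlocks-⊑ _ _ (c-cycle i j a))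
  ... | i , j , i≢j , ¬adj , e = i , j , i≢j , ¬adj , withinBlocks-edge e (same i j)

  -- A cycle meeting both B₁ − B₂ and B₂ − B₁ passes twice through B₁ ∩ B₂ ⊆ K, at non-adjacent
  -- positions, and the clique K supplies the chord.
  withinBlocks-chordal : Chordal H → (∀ w → B₁ w ⊎ B₂ w) →
                         ∀ {K} → IsClique H K → (∀ {w} → B₁ w → B₂ w → w ∈ K) → Chordal withinBlocks
  withinBlocks-chordal chordal cover clique B₁∩B₂⊆K (suc l) 4≤m c cycle@(c-injective , c-cycle)
    with all? (B₂? ∘ c) | all? (B₁? ∘ c)
  ... | yes all₂ | _        = chord-within-block chordal (suc l) 4≤m cycle λ i j → inj₂ (all₂ i , all₂ j)
  ... | no _     | yes all₁ = chord-within-block chordal (suc l) 4≤m cycle λ i j → inj₁ (all₁ i , all₁ j)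
  ... | no ¬all₂ | no ¬all₁ =
    let i₀ , ¬B₂i₀ = ¬∀⟶∃¬ _ _ (B₂? ∘ c) ¬all₂
        j₀ , ¬B₁j₀ = ¬∀⟶∃¬ _ _ (B₁? ∘ c) ¬all₁
        p , q , p≢q , ¬adj , (¬¬B₂p , ¬¬B₁p) , (¬¬B₂q , ¬¬B₁q) =
          CyclicGaps.two-gap-positions (¬? ∘ B₂? ∘ c) (¬? ∘ B₁? ∘ c) apart disjoint ¬B₂i₀ ¬B₁j₀
        B₁p = decidable-stable (B₁? (c p)) ¬¬B₁p
        B₁q = decidable-stable (B₁? (c q)) ¬¬B₁q
        c-pq = clique (c p) (c q) (B₁∩B₂⊆K B₁p (decidable-stable (B₂? (c p)) ¬¬B₂p))
                                  (B₁∩B₂⊆K B₁q (decidable-stable (B₂? (c q)) ¬¬B₂q)) (p≢q ∘ c-injective)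
    in p , q , p≢q , ¬adj , withinBlocks-edge c-pq (inj₁ (B₁p , B₁q))
    where
    apart : ∀ {i j} → CycAdj i j → ¬ B₂ (c i) → ¬ ¬ B₁ (c j)
    apart a ¬B₂i ¬B₁j = [ ¬B₁j ∘ proj₂ , ¬B₂i ∘ proj₁ ]′ (withinBlocks-sameBlock (c-cycle _ _ a))
    disjoint : ∀ i → ¬ B₂ (c i) → ¬ ¬ B₁ (c i)
    disjoint i ¬B₂i ¬B₁i = [ ¬B₁i , ¬B₂i ]′ (cover (c i))

-- Bouchitté–Todinca: two non-adjacent vertices u, v of a potential maximal clique Ω have a
-- common full component. If no component of G − Ω seen by u sees v, separate the components
-- seen by u (together with Ω − v) from the rest (without u): the minimal triangulation H with
-- the edges between the two blocks deleted is still a chordal supergraph of G, as the blocks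
-- meet in the clique Ω, but it lacks the edge uv.
module NonadjacentPair {n} {G : Graph n} {Ω : Subset n} (pmc : IsPMC G Ω) {u v : Fin n}
  (u∈Ω : u ∈ Ω) (v∈Ω : v ∈ Ω) (u≢v : u ≢ v) (¬uv : ¬ Edge G u v) where

  H : Graph n
  H = proj₁ pmc

  Seen : Fin n → Set
  Seen b = ∃ λ a → Edge G u a × b ∈ reach G (∁ Ω) a

  seen? : Decidable Seen
  seen? b = any? λ a → edge? G u a ×-dec b ∈? reach G (∁ Ω) a

  seen-∉Ω : ∀ {b} → Seen b → b ∉ Ω
  seen-∉Ω (a , _ , b∈R) = x∈∁p⇒x∉p (target∈ (reach-walk G a b∈R))

  seen-neighbour : ∀ {b} → Edge G u b → b ∉ Ω → Seen b
  seen-neighbour ub b∉Ω = _ , ub , ∈-reach G (x∉p⇒x∈∁p b∉Ω)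

  seen-step : ∀ {a b} → Seen a → Edge G a b → b ∉ Ω → Seen b
  seen-step (a₀ , ua₀ , a∈R) ab b∉Ω = a₀ , ua₀ , reach-closedIn G a₀ a∈R (x∉p⇒x∈∁p b∉Ω) ab

  module Separation (¬seen-v : ¬ ∃ λ b → Seen b × Edge G b v) where

    B₁ B₂ : Fin n → Set
    B₁ w = Seen w ⊎ (w ∈ Ω × w ≢ v)
    B₂ w = ¬ Seen w × w ≢ u

    B₁? : Decidable B₁
    B₁? w = seen? w ⊎-dec (w ∈? Ω ×-dec ¬? (w ≟ᶠ v))
    B₂? : Decidable B₂
    B₂? w = ¬? (seen? w) ×-dec ¬? (w ≟ᶠ u)

    H′ : Graph n
    H′ = withinBlocks H B₁? B₂?

    sameBlock-seen : ∀ {a b} → Seen a → Edge G a b → SameBlock B₁ B₂ a b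
    sameBlock-seen {a} {b} seen-a ab with b ∈? Ω
    ... | yes b∈Ω = inj₁ (inj₁ seen-a , inj₂ (b∈Ω , λ { refl → ¬seen-v (a , seen-a , ab) }))
    ... | no  b∉Ω = inj₁ (inj₁ seen-a , inj₁ (seen-step seen-a ab b∉Ω))

    sameBlock-u : ∀ {b} → ¬ Seen b → Edge G u b → SameBlock B₁ B₂ u b
    sameBlock-u {b} ¬seen-b ub with b ∈? Ω
    ... | yes b∈Ω = inj₁ (inj₂ (u∈Ω , u≢v) , inj₂ (b∈Ω , λ { refl → ¬uv ub }))
    ... | no  b∉Ω = contradiction (seen-neighbour ub b∉Ω) ¬seen-b

    sameBlock-edge : ∀ {a b} → Edge G a b → SameBlock B₁ B₂ a b
    sameBlock-edge {a} {b} ab with seen? a | seen? b | a ≟ᶠ u | b ≟ᶠ u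
    ... | yes seen-a | _          | _        | _        = sameBlock-seen seen-a ab
    ... | no  _      | yes seen-b | _        | _        = Sum.map swap swap (sameBlock-seen seen-b (edge-sym G ab))
    ... | no  _      | no ¬seen-b | yes refl | _        = sameBlock-u ¬seen-b ab
    ... | no ¬seen-a | no  _      | no  _    | yes refl = Sum.map swap swap (sameBlock-u ¬seen-a (edge-sym G ab))
    ... | no ¬seen-a | no ¬seen-b | no  a≢u  | no  b≢u  = inj₂ ((¬seen-a , a≢u) , (¬seen-b , b≢u))

    cover : ∀ w → B₁ w ⊎ B₂ w
    cover w with seen? w | w ≟ᶠ u
    ... | yes seen-w | _        = inj₁ (inj₁ seen-w)
    ... | no  _      | yes refl = inj₁ (inj₂ (u∈Ω , u≢v))
    ... | no ¬seen-w | no  w≢u  = inj₂ (¬seen-w , w≢u)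

    B₁∩B₂⊆Ω : ∀ {w} → B₁ w → B₂ w → w ∈ Ω
    B₁∩B₂⊆Ω (inj₁ seen-w)     (¬seen-w , _) = contradiction seen-w ¬seen-w
    B₁∩B₂⊆Ω (inj₂ (w∈Ω , _)) _             = w∈Ω

    ¬H′-uv : ¬ Edge H′ u v
    ¬H′-uv uv with withinBlocks-sameBlock H B₁? B₂? uv
    ... | inj₁ (_ , inj₁ seen-v)     = seen-∉Ω seen-v v∈Ω
    ... | inj₁ (_ , inj₂ (_ , v≢v)) = v≢v refl
    ... | inj₂ ((_ , u≢u) , _)      = u≢u refl

    contradicts-minimality : ⊥
    contradicts-minimality =
      minimal (H′ , withinBlocks-chordal H B₁? B₂? chordal cover clique B₁∩B₂⊆Ω ,
               (λ a b ab → withinBlocks-edge H B₁? B₂? (G⊑H a b ab) (sameBlock-edge ab)) ,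
               withinBlocks-⊑ H B₁? B₂? , λ H⊑H′ → ¬H′-uv (H⊑H′ u v (clique u v u∈Ω v∈Ω u≢v)))
      where
      chordal = proj₁ (proj₁ (proj₂ pmc))
      G⊑H = proj₁ (proj₂ (proj₁ (proj₂ pmc)))
      minimal = proj₂ (proj₂ (proj₁ (proj₂ pmc)))
      clique = proj₁ (proj₂ (proj₂ pmc))

  common-component : ∃ λ D → IsComponent G Ω D × InN G D u × InN G D v
  common-component with any? (λ b → seen? b ×-dec edge? G b v)
  ... | no ¬seen-v = ⊥-elim (Separation.contradicts-minimality ¬seen-v)
  ... | yes (b , (a , ua , b∈D) , bv) =
    D , D-comp , (component-avoids G D-comp u∈Ω , a , ∈-reach G a∉Ω , edge-sym G ua) ,
                 (component-avoids G D-comp v∈Ω , b , b∈D , bv)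
    where
    D = reach G (∁ Ω) a
    a∉Ω = source∈ (reach-walk G a b∈D)
    D-comp = reach-isComponent G a∉Ω

⇔-dec : ∀ {P Q : Set} → Dec P → Dec Q → Dec (P ⇔ Q)
⇔-dec P? Q? =
  map′ (λ (to , from) → mk⇔ to from) (λ P⇔Q → Equivalence.to P⇔Q , Equivalence.from P⇔Q)
       ((P? →-dec Q?) ×-dec (Q? →-dec P?))

module ActivePair {n} (G : Graph n) (W Ω S C : Subset n) (x y : Fin n)
  (W-cover : IsVertexCover G W) (pmc : IsPMC G Ω) (S⊆Ω : S ⊆ Ω) (active : IsActivePair G Ω S x y)
  (x∈S : x ∈ S) (y∈S : y ∈ S) (C-comp : IsComponent G S C)
  (C∩Ω : Σ (Fin n) λ v → v ∈ C × v ∈ Ω) where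

  DS Dx Dy DSW DxW DyW : Fin n → Set
  DS v = Σ (Subset n) λ C′ → IsComponent G S C′ × C′ ≢ C × v ∈ C′
  Dx v = Σ (Subset n) λ C′ → IsComponent G Ω C′ × C′ ⊆ C × Sees G x (λ u → u ∈ C′) × v ∈ C′
  Dy v = Σ (Subset n) λ C′ → IsComponent G Ω C′ × C′ ⊆ C × ¬ Sees G x (λ u → u ∈ C′) × v ∈ C′
  DSW v = DS v × v ∈ W
  DxW v = Dx v × v ∈ W
  DyW v = Dy v × v ∈ W

  DxyW : Fin n → Set
  DxyW v = DxW v ⊎ DyW v

  Condition₁ Condition₂ : Set
  Condition₁ = Σ (Fin n) λ t → t ∈ Ω × (∀ v → ((v ∈ Ω × v ∉ S) ⇔ (Edge G t v × v ∈ C)))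
  Condition₂ = Σ (Fin n) λ t → t ∈ Ω × (∀ v → (v ∈ Ω ⇔ (v ≡ t ⊎ Edge G t v)))

  Condition₃ : Fin n → Set
  Condition₃ z = (Sees G z DSW × Sees G z DxyW)
               ⊎ (¬ Sees G z DSW × Sees G z (λ v → DxW v ⊎ v ≡ x)
                  × Sees G z (λ v → DyW v ⊎ v ≡ y) × Sees G z DxyW)

  condition₁? : Dec Condition₁
  condition₁? = any? λ t → t ∈? Ω ×-dec
                  all? λ v → ⇔-dec (v ∈? Ω ×-dec ¬? (v ∈? S)) (edge? G t v ×-dec v ∈? C)

  condition₂? : Dec Condition₂
  condition₂? = any? λ t → t ∈? Ω ×-dec all? λ v → ⇔-dec (v ∈? Ω) (v ≟ᶠ t ⊎-dec edge? G t v)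

  C₁ : Subset n
  C₁ = proj₁ (proj₁ active)
  C₁-comp : IsComponent G Ω C₁
  C₁-comp = proj₁ (proj₂ (proj₁ active))
  S⊆N[C₁] : ∀ v → v ∈ S → InN G C₁ v
  S⊆N[C₁] = proj₁ (proj₂ (proj₂ (proj₁ active)))
  N[C₁]⊆S : ∀ v → InN G C₁ v → v ∈ S
  N[C₁]⊆S = proj₂ (proj₂ (proj₂ (proj₁ active)))
  x∈Ω : x ∈ Ω
  x∈Ω = proj₁ (proj₂ active)
  x≢y : x ≢ y
  x≢y = proj₁ (proj₂ (proj₂ (proj₂ active)))
  ¬x⁺y : ¬ EdgePlus G Ω S x y
  ¬x⁺y = proj₂ (proj₂ (proj₂ (proj₂ active)))

  v₀ : Fin n
  v₀ = proj₁ C∩Ω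
  v₀∈C : v₀ ∈ C
  v₀∈C = proj₁ (proj₂ C∩Ω)
  v₀∈Ω : v₀ ∈ Ω
  v₀∈Ω = proj₂ (proj₂ C∩Ω)

  common-component : ∀ {a b} → a ∈ Ω → b ∈ Ω → a ≢ b → ¬ Edge G a b →
                     ∃ λ D → IsComponent G Ω D × InN G D a × InN G D b
  common-component = NonadjacentPair.common-component pmc

  ∁Ω⊆∁S : ∁ Ω ⊆ ∁ S
  ∁Ω⊆∁S w∉Ω = x∉p⇒x∈∁p λ w∈S → x∈∁p⇒x∉p w∉Ω (S⊆Ω w∈S)

  C-avoids-S : ∀ {w} → w ∈ C → w ∉ S
  C-avoids-S = x∈∁p⇒x∉p ∘ proj₁ C-comp

  neighbour∈W : ∀ {z a} → z ∉ W → Edge G z a → a ∈ W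
  neighbour∈W z∉W za = [ (λ z∈W → contradiction z∈W z∉W) , id ]′ (W-cover _ _ za)

  walk-in-component : ∀ {D d₁ d₂} → IsComponent G Ω D → d₁ ∈ D → d₂ ∈ D → Walk G (∁ S) d₁ d₂
  walk-in-component (D⊆∁Ω , (_ , walks) , _) d₁∈D d₂∈D =
    Walk-mono (∁Ω⊆∁S ∘ D⊆∁Ω) (walks _ _ d₁∈D d₂∈D)

  Ω∖S⊆C : ∀ {w} → w ∈ Ω → w ∉ S → w ∈ C
  Ω∖S⊆C {w} w∈Ω w∉S with w ≟ᶠ v₀ | edge? G v₀ w
  ... | yes refl | _        = v₀∈C
  ... | no _     | yes v₀w  = component-closedIn G C-comp v₀∈C (x∉p⇒x∈∁p w∉S) v₀w
  ... | no w≢v₀  | no ¬v₀w  =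
    let D , D-comp , (_ , d₁ , d₁∈D , d₁v₀) , (_ , d₂ , d₂∈D , d₂w) =
          common-component v₀∈Ω w∈Ω (w≢v₀ ∘ ≡-sym) ¬v₀w
        d₁⇝d₂ = walk-in-component D-comp d₁∈D d₂∈D
    in component-walk G C-comp v₀∈C
         (step (proj₁ C-comp v₀∈C) (edge-sym G d₁v₀)
           (d₁⇝d₂ ++ʷ step (target∈ d₁⇝d₂) d₂w (here (x∉p⇒x∈∁p w∉S))))

  component-in-C : ∀ {D d} → IsComponent G Ω D → d ∈ D → d ∈ C → D ⊆ C
  component-in-C D-comp d∈D d∈C d′∈D = component-walk G C-comp d∈C (walk-in-component D-comp d∈D d′∈D)

  common-component-in-C : ∀ {a b} → a ∈ Ω → b ∈ Ω → a ≢ b → ¬ Edge G a b → b ∈ C →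
                          ∃ λ D → IsComponent G Ω D × D ⊆ C × InN G D a × InN G D b
  common-component-in-C a∈Ω b∈Ω a≢b ¬ab b∈C =
    let D , D-comp , a∈N[D] , b∈N[D]@(_ , d , d∈D , db) = common-component a∈Ω b∈Ω a≢b ¬ab
        d∈C = component-closedIn G C-comp b∈C (∁Ω⊆∁S (proj₁ D-comp d∈D)) (edge-sym G db)
    in D , D-comp , component-in-C D-comp d∈D d∈C , a∈N[D] , b∈N[D]

  -- Otherwise D would contain v₀ ∈ C ∩ Ω.
  component-in-C-not-full : ∀ {D} → IsComponent G Ω D → D ⊆ C → ¬ (∀ w → InN G D w → w ∈ S)
  component-in-C-not-full D-comp@(_ , ((d , d∈D) , _) , _) D⊆C N[D]⊆S =
    component-avoids G D-comp v₀∈Ω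
      (walk-target-in (closedIn-∁ G N[D]⊆S) d∈D
        (Walk-mono (proj₁ C-comp) (proj₂ (proj₁ (proj₂ C-comp)) _ _ (D⊆C d∈D) v₀∈C)))

  C₁-comp-S : IsComponent G S C₁
  C₁-comp-S = ∁Ω⊆∁S ∘ proj₁ C₁-comp , proj₁ (proj₂ C₁-comp) , maximal
    where
    maximal : ∀ C′ → C₁ ⊆ C′ → C′ ⊆ ∁ S → Connected G C′ → C′ ⊆ C₁
    maximal C′ C₁⊆C′ C′⊆∁S (_ , walks) w∈C′ with proj₁ (proj₁ (proj₂ C₁-comp))
    ... | c , c∈C₁ =
      walk-target-in (closedIn-∁ G N[C₁]⊆S) c∈C₁ (Walk-mono C′⊆∁S (walks _ _ (C₁⊆C′ c∈C₁) w∈C′))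

  C₁≢C : C₁ ≢ C
  C₁≢C C₁≡C = component-avoids G C₁-comp v₀∈Ω (subst (v₀ ∈_) (≡-sym C₁≡C) v₀∈C)

  sees-x? : ∀ D → Dec (Sees G x (λ u → u ∈ D))
  sees-x? D = any? λ a → a ∈? D ×-dec edge? G x a

  sees-DxyW : ∀ {z D} → z ∉ W → IsComponent G Ω D → D ⊆ C → InN G D z → Sees G z DxyW
  sees-DxyW {z} {D} z∉W D-comp D⊆C (_ , d , d∈D , dz) with sees-x? D
  ... | yes x-sees-D = d , inj₁ ((D , D-comp , D⊆C , x-sees-D , d∈D) , neighbour∈W z∉W zd) , zd
    where zd = edge-sym G dz
  ... | no ¬x-sees-D = d , inj₂ ((D , D-comp , D⊆C , ¬x-sees-D , d∈D) , neighbour∈W z∉W zd) , zd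
    where zd = edge-sym G dz

  sees-DxyW-outside-Ω : ∀ {z w} → z ∉ W → z ∈ Ω → w ∈ C → w ∉ Ω → Edge G z w →
                           Sees G z DxyW
  sees-DxyW-outside-Ω z∉W z∈Ω w∈C w∉Ω zw =
    sees-DxyW z∉W D-comp (component-in-C D-comp w∈D w∈C)
                 (component-avoids G D-comp z∈Ω , _ , w∈D , edge-sym G zw)
    where
    w∈∁Ω = x∉p⇒x∈∁p w∉Ω
    D-comp = reach-isComponent G w∈∁Ω
    w∈D = ∈-reach G w∈∁Ω

  C-¬sees-DSW : ∀ {z} → z ∈ C → ¬ Sees G z DSW
  C-¬sees-DSW z∈C (a , ((C′ , C′-comp , C′≢C , a∈C′) , _) , za) =
    C′≢C (⊆-antisym (component-⊆ G C′-comp C-comp a∈C′ a∈C)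
                    (component-⊆ G C-comp C′-comp a∈C a∈C′))
    where
    a∈C = component-closedIn G C-comp z∈C (proj₁ C′-comp a∈C′) za

  S-sees-DSW : ∀ {z} → z ∉ W → z ∈ S → Sees G z DSW
  S-sees-DSW z∉W z∈S =
    let _ , a , a∈C₁ , az = S⊆N[C₁] _ z∈S
    in a , ((C₁ , C₁-comp-S , C₁≢C , a∈C₁) , neighbour∈W z∉W (edge-sym G az)) , edge-sym G az

  ¬Condition₁-witness : ∀ {z} → ¬ Condition₁ → z ∈ Ω →
                        (∃ λ t → t ∈ Ω × t ∉ S × ¬ Edge G z t) ⊎ (∃ λ w → w ∈ C × w ∉ Ω × Edge G z w)
  ¬Condition₁-witness {z} ¬c₁ z∈Ω with any? (λ t → t ∈? Ω ×-dec ¬? (t ∈? S) ×-dec ¬? (edge? G z t))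
  ... | yes far = inj₁ far
  ... | no ¬far with any? (λ w → w ∈? C ×-dec ¬? (w ∈? Ω) ×-dec edge? G z w)
  ...   | yes out = inj₂ out
  ...   | no ¬out = contradiction (z , z∈Ω , λ v → mk⇔ (to v) (from v)) ¬c₁
    where
    to : ∀ v → v ∈ Ω × v ∉ S → Edge G z v × v ∈ C
    to v (v∈Ω , v∉S) =
      decidable-stable (edge? G z v) (λ ¬zv → ¬far (v , v∈Ω , v∉S , ¬zv)) , Ω∖S⊆C v∈Ω v∉S
    from : ∀ v → Edge G z v × v ∈ C → v ∈ Ω × v ∉ S
    from v (zv , v∈C) = decidable-stable (v ∈? Ω) (λ v∉Ω → ¬out (v , v∈C , v∉Ω , zv)) , C-avoids-S v∈C

  ¬Condition₂-witness : ∀ {z} → ¬ Condition₂ → z ∈ Ω →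
                        (∃ λ w → w ∈ Ω × w ≢ z × ¬ Edge G z w) ⊎ (∃ λ w → w ∉ Ω × Edge G z w)
  ¬Condition₂-witness {z} ¬c₂ z∈Ω with any? (λ w → w ∈? Ω ×-dec ¬? (w ≟ᶠ z) ×-dec ¬? (edge? G z w))
  ... | yes far = inj₁ far
  ... | no ¬far with any? (λ w → ¬? (w ∈? Ω) ×-dec edge? G z w)
  ...   | yes out = inj₂ out
  ...   | no ¬out = contradiction (z , z∈Ω , λ v → mk⇔ (to v) (from v)) ¬c₂
    where
    to : ∀ v → v ∈ Ω → v ≡ z ⊎ Edge G z v
    to v v∈Ω with v ≟ᶠ z
    ... | yes v≡z = inj₁ v≡z
    ... | no  v≢z = inj₂ (decidable-stable (edge? G z v) (λ ¬zv → ¬far (v , v∈Ω , v≢z , ¬zv)))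
    from : ∀ v → v ≡ z ⊎ Edge G z v → v ∈ Ω
    from v (inj₁ refl) = z∈Ω
    from v (inj₂ zv)   = decidable-stable (v ∈? Ω) (λ v∉Ω → ¬out (v , v∉Ω , zv))

  S-sees-DxyW : ∀ {z} → ¬ Condition₁ → z ∉ W → z ∈ S → Sees G z DxyW
  S-sees-DxyW {z} ¬c₁ z∉W z∈S with ¬Condition₁-witness ¬c₁ (S⊆Ω z∈S)
  ... | inj₁ (t , t∈Ω , t∉S , ¬zt) =
    let D , D-comp , D⊆C , z∈N[D] , _ =
          common-component-in-C (S⊆Ω z∈S) t∈Ω (λ { refl → t∉S z∈S }) ¬zt (Ω∖S⊆C t∈Ω t∉S)
    in sees-DxyW z∉W D-comp D⊆C z∈N[D]
  ... | inj₂ (w , w∈C , w∉Ω , zw) = sees-DxyW-outside-Ω z∉W (S⊆Ω z∈S) w∈C w∉Ω zw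

  Ω∖S-sees-DxW∪x : ∀ {z} → z ∉ W → z ∈ Ω → z ∉ S → Sees G z (λ v → DxW v ⊎ v ≡ x)
  Ω∖S-sees-DxW∪x {z} z∉W z∈Ω z∉S with edge? G z x
  ... | yes zx = x , inj₂ refl , zx
  ... | no ¬zx =
    let D , D-comp , D⊆C , (_ , a , a∈D , ax) , (_ , d , d∈D , dz) =
          common-component-in-C x∈Ω z∈Ω (λ { refl → z∉S x∈S }) (¬zx ∘ edge-sym G) (Ω∖S⊆C z∈Ω z∉S)
        zd = edge-sym G dz
    in d , inj₁ ((D , D-comp , D⊆C , (a , a∈D , edge-sym G ax) , d∈D) , neighbour∈W z∉W zd) , zd

  -- A component through z that saw x would join x and y in G⁺.
  Ω∖S-sees-DyW∪y : ∀ {z} → z ∉ W → z ∈ Ω → z ∉ S → Sees G z (λ v → DyW v ⊎ v ≡ y)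
  Ω∖S-sees-DyW∪y {z} z∉W z∈Ω z∉S with edge? G z y
  ... | yes zy = y , inj₂ refl , zy
  ... | no ¬zy
    with common-component-in-C (S⊆Ω y∈S) z∈Ω (λ { refl → z∉S y∈S }) (¬zy ∘ edge-sym G) (Ω∖S⊆C z∈Ω z∉S)
  ...   | D , D-comp , D⊆C , y∈N[D] , z∈N[D]@(_ , d , d∈D , dz) with sees-x? D
  ...     | yes (a , a∈D , xa) =
    contradiction (inj₂ (x≢y , D , D-comp , (λ N[D]⊆S → z∉S (N[D]⊆S z z∈N[D])) ,
                         (component-avoids G D-comp x∈Ω , a , a∈D , edge-sym G xa) , y∈N[D])) ¬x⁺y
  ...     | no ¬x-sees-D =
    d , inj₁ ((D , D-comp , D⊆C , ¬x-sees-D , d∈D) , neighbour∈W z∉W (edge-sym G dz)) , edge-sym G dz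

  Ω∖S-sees-DxyW : ∀ {z} → ¬ Condition₂ → z ∉ W → z ∈ Ω → z ∉ S → Sees G z DxyW
  Ω∖S-sees-DxyW {z} ¬c₂ z∉W z∈Ω z∉S with ¬Condition₂-witness ¬c₂ z∈Ω
  ... | inj₁ (w , w∈Ω , w≢z , ¬zw) =
    let D , D-comp , D⊆C , _ , z∈N[D] =
          common-component-in-C w∈Ω z∈Ω w≢z (¬zw ∘ edge-sym G) (Ω∖S⊆C z∈Ω z∉S)
    in sees-DxyW z∉W D-comp D⊆C z∈N[D]
  ... | inj₂ (w , w∉Ω , zw) =
    let w∈C = component-closedIn G C-comp (Ω∖S⊆C z∈Ω z∉S) (∁Ω⊆∁S (x∉p⇒x∈∁p w∉Ω)) zw
    in sees-DxyW-outside-Ω z∉W z∈Ω w∈C w∉Ω zw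

  ∈Ω⇒Condition₃ : ¬ Condition₁ → ¬ Condition₂ → ∀ {z} → z ∉ W → z ∈ Ω → Condition₃ z
  ∈Ω⇒Condition₃ ¬c₁ ¬c₂ {z} z∉W z∈Ω with z ∈? S
  ... | yes z∈S = inj₁ (S-sees-DSW z∉W z∈S , S-sees-DxyW ¬c₁ z∉W z∈S)
  ... | no  z∉S = inj₂ (C-¬sees-DSW (Ω∖S⊆C z∈Ω z∉S) , Ω∖S-sees-DxW∪x z∉W z∈Ω z∉S ,
                        Ω∖S-sees-DyW∪y z∉W z∈Ω z∉S , Ω∖S-sees-DxyW ¬c₂ z∉W z∈Ω z∉S)

  component-of : ∀ {z} → z ∉ Ω → Sees G z DxyW → ∃ λ D → IsComponent G Ω D × D ⊆ C × z ∈ D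
  component-of z∉Ω (b , inj₁ ((D , D-comp , D⊆C , _ , b∈D) , _) , zb) =
    D , D-comp , D⊆C , component-closedIn G D-comp b∈D (x∉p⇒x∈∁p z∉Ω) (edge-sym G zb)
  component-of z∉Ω (b , inj₂ ((D , D-comp , D⊆C , _ , b∈D) , _) , zb) =
    D , D-comp , D⊆C , component-closedIn G D-comp b∈D (x∉p⇒x∈∁p z∉Ω) (edge-sym G zb)

  ∉Ω⇒¬Condition₃ : ∀ {z} → z ∉ Ω → ¬ Condition₃ z
  ∉Ω⇒¬Condition₃ z∉Ω (inj₁ (sees-DSW , sees-Dxy)) =
    let _ , _ , D⊆C , z∈D = component-of z∉Ω sees-Dxy in C-¬sees-DSW (D⊆C z∈D) sees-DSW
  ∉Ω⇒¬Condition₃ {z} z∉Ω (inj₂ (_ , sees-x , sees-y , sees-Dxy)) with component-of z∉Ω sees-Dxy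
  ... | D , D-comp , D⊆C , z∈D =
    let w , w∈D , xw = x-sees-D sees-x
    in ¬x⁺y (inj₂ (x≢y , D , D-comp , component-in-C-not-full D-comp D⊆C ,
                   (component-avoids G D-comp x∈Ω , w , w∈D , edge-sym G xw) , y∈N[D] sees-y))
    where
    joins : ∀ {D′ a} → IsComponent G Ω D′ → a ∈ D′ → Edge G z a → z ∈ D′
    joins D′-comp a∈D′ za = component-closedIn G D′-comp a∈D′ (x∉p⇒x∈∁p z∉Ω) (edge-sym G za)

    x-sees-D : Sees G z (λ v → DxW v ⊎ v ≡ x) → Sees G x (λ u → u ∈ D)
    x-sees-D (_ , inj₂ refl , zx) = z , z∈D , edge-sym G zx
    x-sees-D (_ , inj₁ ((D′ , D′-comp , _ , (w , w∈D′ , xw) , a∈D′) , _) , za) =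
      w , component-⊆ G D′-comp D-comp (joins D′-comp a∈D′ za) z∈D w∈D′ , xw

    y∈N[D] : Sees G z (λ v → DyW v ⊎ v ≡ y) → InN G D y
    y∈N[D] (_ , inj₂ refl , zy) = component-avoids G D-comp (S⊆Ω y∈S) , z , z∈D , zy
    y∈N[D] (_ , inj₁ ((D′ , D′-comp , _ , ¬x-sees-D′ , b∈D′) , _) , zb) =
      let w , w∈D , xw = x-sees-D sees-x
      in contradiction (w , component-⊆ G D-comp D′-comp z∈D (joins D′-comp b∈D′ zb) w∈D , xw) ¬x-sees-D′

lemma2 : ∀ {n} (G : Graph n) (W Ω S C : Subset n) (x y : Fin n) →
  IsVertexCover G W →
  IsPMC G Ω →
  S ⊆ Ω →
  IsActivePair G Ω S x y →
  x ∈ S → y ∈ S →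
  IsComponent G S C →
  (Σ (Fin n) λ v → v ∈ C × v ∈ Ω) →
  let DS : Fin n → Set
      DS v = Σ (Subset n) λ C′ → IsComponent G S C′ × C′ ≢ C × v ∈ C′
      Dx : Fin n → Set
      Dx v = Σ (Subset n) λ C′ → IsComponent G Ω C′ × C′ ⊆ C × Sees G x (λ u → u ∈ C′) × v ∈ C′
      Dy : Fin n → Set
      Dy v = Σ (Subset n) λ C′ → IsComponent G Ω C′ × C′ ⊆ C × ¬ Sees G x (λ u → u ∈ C′) × v ∈ C′
      DSW : Fin n → Set
      DSW v = DS v × v ∈ W
      DxW : Fin n → Set
      DxW v = Dx v × v ∈ W
      DyW : Fin n → Set
      DyW v = Dy v × v ∈ W
  in (Σ (Fin n) λ t → t ∈ Ω × (∀ v → ((v ∈ Ω × v ∉ S) ⇔ (Edge G t v × v ∈ C))))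
     ⊎ (Σ (Fin n) λ t → t ∈ Ω × (∀ v → (v ∈ Ω ⇔ (v ≡ t ⊎ Edge G t v))))
     ⊎ (∀ z → z ∉ W →
          (z ∈ Ω ⇔
            ((Sees G z DSW × Sees G z (λ v → DxW v ⊎ DyW v))
             ⊎ (¬ Sees G z DSW × Sees G z (λ v → DxW v ⊎ v ≡ x)
                × Sees G z (λ v → DyW v ⊎ v ≡ y) × Sees G z (λ v → DxW v ⊎ DyW v)))))
lemma2 G W Ω S C x y W-cover pmc S⊆Ω active x∈S y∈S C-comp C∩Ω = conclude condition₁? condition₂?
  where
  open ActivePair G W Ω S C x y W-cover pmc S⊆Ω active x∈S y∈S C-comp C∩Ω

  conclude : Dec Condition₁ → Dec Condition₂ →
             Condition₁ ⊎ Condition₂ ⊎ (∀ z → z ∉ W → z ∈ Ω ⇔ Condition₃ z)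
  conclude (yes c₁) _        = inj₁ c₁
  conclude (no _)   (yes c₂) = inj₂ (inj₁ c₂)
  conclude (no ¬c₁) (no ¬c₂) = inj₂ (inj₂ λ z z∉W →
    mk⇔ (∈Ω⇒Condition₃ ¬c₁ ¬c₂ z∉W) λ c₃ → decidable-stable (z ∈? Ω) λ z∉Ω → ∉Ω⇒¬Condition₃ z∉Ω c₃)
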